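{- Let $k\geq 2$ and let $(x_n)_{n\geq 0}$ be a sequence of integers satisfying $x_n=b_1x_{n-1}+b_2x_{n-2}+\dots+b_kx_{n-k}$ for all integers $n\geq k$, where $b_1,\dots,b_k\in\mathbb{Z}$, $b_k\neq 0$, with initial values $x_0=x_1=\dots=x_{k-2}=0$, $x_{k-1}=1$. Suppose that the characteristic polynomial $x^k-b_1x^{k-1}-\dots-b_k$ equals $(x-a)^k$ for some $a\in\mathbb{Z}$. If $p$ is a prime with $p\nmid a$, then the quotient set of $(x_n)_{n\geq 0}$ is dense in $\mathbb{Q}_p$.
   Context: The quotient set (ratio set) of a sequence $(x_n)_{n\ge0}$ of integers is $\{x_m/x_n : m,n\geq 0,\ x_n\neq 0\}$. $\mathbb{Q}_p$ denotes the field of $p$-adic numbers with the $p$-adic topology. -}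

module Defs where

open import Data.Nat as ℕ using (ℕ; zero; suc; _∸_)
open import Data.Nat.Divisibility using (_∣_)
open import Data.Integer as ℤ using (ℤ; +_; 0ℤ; 1ℤ)
open import Data.Integer.Properties as ℤP using ()
open import Data.Rational as ℚ using (ℚ; 0ℚ; ↥_; ↧ₙ_)
open import Data.Rational.Properties as ℚP using ()
open import Data.List using (List; []; _∷_; map; foldr; upTo; _++_; [_])
open import Relation.Nullary using (¬_)
open import Relation.Binary.PropositionalEquality using (_≡_; _≢_; refl; sym; trans; cong)

-- Integer sums and polynomials (coefficient lists, constant term first)

sumℤ : List ℤ → ℤ
sumℤ = foldr ℤ._+_ 0ℤ

Poly : Set
Poly = List ℤ

infixl 6 _+ₚ_
infixl 7 _*ₚ_

_+ₚ_ : Poly → Poly → Poly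
[]       +ₚ q        = q
(c ∷ p)  +ₚ []       = c ∷ p
(c ∷ p)  +ₚ (d ∷ q)  = (c ℤ.+ d) ∷ (p +ₚ q)

_*ₚ_ : Poly → Poly → Poly
[]      *ₚ q = []
(c ∷ p) *ₚ q = map (c ℤ.*_) q +ₚ (0ℤ ∷ (p *ₚ q))

_^ₚ_ : Poly → ℕ → Poly
p ^ₚ zero  = [ 1ℤ ]
p ^ₚ suc n = p *ₚ (p ^ₚ n)

X-_ : ℤ → Poly
X- a = ℤ.- a ∷ 1ℤ ∷ []

-- characteristic polynomial  X^k - b₁ X^(k-1) - ... - b_k
-- (coefficient of X^j for j < k is - b_(k-j); coefficient of X^k is 1)
charPoly : ℕ → (ℕ → ℤ) → Poly
charPoly k b = map (λ j → ℤ.- b (k ∸ j)) (upTo k) ++ [ 1ℤ ]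

Recurrence : ℕ → (ℕ → ℤ) → (ℕ → ℤ) → Set
Recurrence k b x =
  ∀ n → k ℕ.≤ n → x n ≡ sumℤ (map (λ i → b (suc i) ℤ.* x (n ∸ suc i)) (upTo k))

InitialValues : ℕ → (ℕ → ℤ) → Set
InitialValues k x = (∀ i → suc i ℕ.< k → x i ≡ 0ℤ) × (x (k ∸ 1) ≡ 1ℤ)
  where open import Data.Product using (_×_)

fromℤ : ℤ → ℚ
fromℤ z = z ℚ./ 1

fromℤ-≢0 : ∀ z → z ≢ 0ℤ → fromℤ z ≢ 0ℚ
fromℤ-≢0 z z≢0 eq = z≢0 (trans (sym (ℚP.↥-/ z 1))
  (trans (cong (λ r → (↥ r) ℤ.* g) eq) (ℤP.*-zeroˡ g)))
  where
  open import Data.Integer.GCD using (gcd)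
  g = gcd z (+ 1)

quot : (x : ℕ → ℤ) (m n : ℕ) → x n ≢ 0ℤ → ℚ
quot x m n nz = ℚ._÷_ (fromℤ (x m)) (fromℤ (x n)) {{ℚ.≢-nonZero (fromℤ-≢0 (x n) nz)}}

-- p-adic smallness:  |r|_p ≤ p^(-e).
-- For r in lowest terms (numerator ↥ r, denominator ↧ₙ r), this holds iff
-- p^e divides the numerator and p does not divide the denominator.

PAdicSmall : ℕ → ℕ → ℚ → Set
PAdicSmall p e r = ((p ℕ.^ e) ∣ ℤ.∣ ↥ r ∣) × ¬ (p ∣ ↧ₙ r)
  where open import Data.Product using (_×_)

-- Since ℚ is dense in ℚ_p and
-- the balls {y : |y - q|_p ≤ p^(-e)} (q ∈ ℚ, e ∈ ℕ) form a base of the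
-- p-adic topology, this is: every such ball meets the quotient set.
QuotientSetDenseInQp : ℕ → (ℕ → ℤ) → Set
QuotientSetDenseInQp p x =
  ∀ (q : ℚ) (e : ℕ) → Σ ℕ λ m → Σ ℕ λ n → Σ (x n ≢ 0ℤ) λ nz →
    PAdicSmall p e (quot x m n nz ℚ.- q)
  where open import Data.Product using (Σ)

-- Since the characteristic polynomial is (X - a)^k, the sequence is x_n = C(n, k-1) a^(n-k+1); with
-- j = k - 2 and Γ(N) = (N+1)(N+2)⋯(N+j) this reads (j+1)! a x_(N+j) = N Γ(N) a^N, and Γ(N) ≡ j! (mod P)
-- whenever P ∣ N. Given q = A/B and e, write B j! = p^h D with p ∤ D, put P = p^(h+e+1), take ρ ≥ 1 with
-- a^ρ ≡ 1 (mod P) (by pigeonhole, as p ∤ a) and S ≡ A (mod P). For N = PρB and N′ = PρS,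
--   x_(N′+j) / x_(N+j) - A/B = (S a^(N′-N) Γ(N′) - A Γ(N)) / (B Γ(N)),
-- whose numerator is ≡ A j! - A j! ≡ 0 (mod P), while the denominator is ≡ B j! (mod p^(h+1)), hence is
-- p^h times a p-adic unit. So the difference has p-adic absolute value at most p^(-e).

module Submission where

open import Defs
open import Data.Nat as ℕ using (ℕ; zero; suc; _≥_; _<_; _≤_; z≤n; s≤s; _∸_; _!)
import Data.Nat.Properties as ℕₚ
open import Data.Nat.Divisibility as ℕ∣ using (divides) renaming (_∣_ to _∣ℕ_)
open import Data.Nat.Coprimality using (Coprime; recompute)
open import Data.Nat.Primality using (Prime; euclidsLemma; prime⇒nonZero; prime⇒nonTrivial)
open import Data.Nat.Induction using (<-rec)
open import Data.Integer as ℤ using (ℤ; 0ℤ; 1ℤ; +_; _+_; _*_; _-_; -_; _^_; ∣_∣; _%ℕ_; _/ℕ_)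
import Data.Integer.Properties as ℤₚ
import Data.Integer.DivMod as ℤ÷
open import Data.Integer.Divisibility using (_∣_)
import Data.Integer.Divisibility.Signed as ℤ∣
import Data.Integer.GCD as ℤgcd
open import Data.Integer.Tactic.RingSolver using (solve-∀)
open import Data.Rational as ℚ using (ℚ; mkℚ; ↥_; ↧_; ↧ₙ_)
import Data.Rational.Properties as ℚₚ
open import Data.Rational.Unnormalised using (*≡*) renaming (_≃_ to _≃ᵘ_; ↥_ to ↥ᵘ_; ↧_ to ↧ᵘ_)
open import Data.Fin using (toℕ; fromℕ<)
import Data.Fin.Properties as Finₚ
open import Data.List using ([]; _∷_; map; [_]; _++_; upTo; applyUpTo)
import Data.List.Properties as Listₚ
open import Data.Product using (Σ; ∃; _×_; _,_)
open import Data.Sum using (inj₁; inj₂)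
open import Data.Empty using (⊥-elim)
open import Function using (_∘_)
open import Relation.Nullary using (¬_; yes; no)
open import Relation.Binary.PropositionalEquality
  using (_≡_; _≢_; refl; sym; trans; cong; cong₂; subst; subst₂; _≗_; module ≡-Reasoning)

-- Shift operators

-- act P f is P(E) f for the shift operator E f = f ∘ suc.
act : Poly → (ℕ → ℤ) → ℕ → ℤ
act []      f n = 0ℤ
act (c ∷ P) f n = c * f n + act P f (suc n)

act-cong : ∀ P {f g} → f ≗ g → act P f ≗ act P g
act-cong []      f≗g n = refl
act-cong (c ∷ P) f≗g n = cong₂ (λ u v → c * u + v) (f≗g n) (act-cong P f≗g (suc n))

act-+ₚ : ∀ P Q f n → act (P +ₚ Q) f n ≡ act P f n + act Q f n
act-+ₚ []      Q       f n = sym (ℤₚ.+-identityˡ _)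
act-+ₚ (c ∷ P) []      f n = sym (ℤₚ.+-identityʳ _)
act-+ₚ (c ∷ P) (d ∷ Q) f n = begin
  (c + d) * f n + act (P +ₚ Q) f (suc n)
    ≡⟨ cong (_+_ ((c + d) * f n)) (act-+ₚ P Q f (suc n)) ⟩
  (c + d) * f n + (act P f (suc n) + act Q f (suc n))
    ≡⟨ regroup c d (f n) (act P f (suc n)) (act Q f (suc n)) ⟩
  c * f n + act P f (suc n) + (d * f n + act Q f (suc n)) ∎
  where
  open ≡-Reasoning
  regroup : ∀ c d u v w → (c + d) * u + (v + w) ≡ c * u + v + (d * u + w)
  regroup = solve-∀

act-scale : ∀ c Q f n → act (map (c *_) Q) f n ≡ c * act Q f n
act-scale c []      f n = sym (ℤₚ.*-zeroʳ c)
act-scale c (d ∷ Q) f n = begin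
  c * d * f n + act (map (c *_) Q) f (suc n) ≡⟨ cong (_+_ (c * d * f n)) (act-scale c Q f (suc n)) ⟩
  c * d * f n + c * act Q f (suc n)          ≡⟨ factor c d (f n) (act Q f (suc n)) ⟩
  c * (d * f n + act Q f (suc n))            ∎
  where
  open ≡-Reasoning
  factor : ∀ c d u v → c * d * u + c * v ≡ c * (d * u + v)
  factor = solve-∀

act-*ₚ : ∀ P Q f n → act (P *ₚ Q) f n ≡ act P (act Q f) n
act-*ₚ []      Q f n = refl
act-*ₚ (c ∷ P) Q f n = begin
  act (map (c *_) Q +ₚ (0ℤ ∷ P *ₚ Q)) f n
    ≡⟨ act-+ₚ (map (c *_) Q) (0ℤ ∷ P *ₚ Q) f n ⟩
  act (map (c *_) Q) f n + (0ℤ * f n + act (P *ₚ Q) f (suc n))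
    ≡⟨ cong₂ (λ u v → u + (0ℤ * f n + v)) (act-scale c Q f n) (act-*ₚ P Q f (suc n)) ⟩
  c * act Q f n + (0ℤ * f n + act P (act Q f) (suc n))
    ≡⟨ cong (_+_ (c * act Q f n)) (ℤₚ.+-identityˡ _) ⟩
  c * act Q f n + act P (act Q f) (suc n) ∎
  where open ≡-Reasoning

act-[1] : ∀ f → act [ 1ℤ ] f ≗ f
act-[1] f n = trans (ℤₚ.+-identityʳ _) (ℤₚ.*-identityˡ _)

-- binomialSeq a t n = C(n, t) · a^(n - t), generated by Pascal's rule.
binomialSeq : ℤ → ℕ → ℕ → ℤ
binomialSeq a zero    n       = a ^ n
binomialSeq a (suc t) zero    = 0ℤ
binomialSeq a (suc t) (suc n) = binomialSeq a t n + a * binomialSeq a (suc t) n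

binomialSeq-below : ∀ a {t i} → i < t → binomialSeq a t i ≡ 0ℤ
binomialSeq-below a {suc t} {zero}  i<t       = refl
binomialSeq-below a {suc t} {suc i} (s≤s i<t) = begin
  binomialSeq a t i + a * binomialSeq a (suc t) i
    ≡⟨ cong₂ (λ u v → u + a * v) (binomialSeq-below a i<t) (binomialSeq-below a (ℕₚ.m<n⇒m<1+n i<t)) ⟩
  0ℤ + a * 0ℤ
    ≡⟨ ℤₚ.+-identityˡ (a * 0ℤ) ⟩
  a * 0ℤ
    ≡⟨ ℤₚ.*-zeroʳ a ⟩
  0ℤ ∎
  where open ≡-Reasoning

binomialSeq-diagonal : ∀ a t → binomialSeq a t t ≡ 1ℤ
binomialSeq-diagonal a zero    = refl
binomialSeq-diagonal a (suc t) = begin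
  binomialSeq a t t + a * binomialSeq a (suc t) t
    ≡⟨ cong₂ (λ u v → u + a * v) (binomialSeq-diagonal a t) (binomialSeq-below a (ℕₚ.n<1+n t)) ⟩
  1ℤ + a * 0ℤ
    ≡⟨ cong (_+_ 1ℤ) (ℤₚ.*-zeroʳ a) ⟩
  1ℤ ∎
  where open ≡-Reasoning

act[X-a]-binomialSeq-suc : ∀ a t → act (X- a) (binomialSeq a (suc t)) ≗ binomialSeq a t
act[X-a]-binomialSeq-suc a t n = telescope a (binomialSeq a (suc t) n) (binomialSeq a t n)
  where
  telescope : ∀ a u v → (- a) * u + (1ℤ * (v + a * u) + 0ℤ) ≡ v
  telescope = solve-∀

act[X-a]-binomialSeq-zero : ∀ a → act (X- a) (binomialSeq a 0) ≗ λ _ → 0ℤ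
act[X-a]-binomialSeq-zero a n = cancel a (a ^ n)
  where
  cancel : ∀ a u → (- a) * u + (1ℤ * (a * u) + 0ℤ) ≡ 0ℤ
  cancel = solve-∀

act[X-a]^s-binomialSeq : ∀ a s t → act ((X- a) ^ₚ s) (binomialSeq a (s ℕ.+ t)) ≗ binomialSeq a t
act[X-a]^s-binomialSeq a zero    t n = act-[1] (binomialSeq a t) n
act[X-a]^s-binomialSeq a (suc s) t n = begin
  act ((X- a) *ₚ (X- a) ^ₚ s) (binomialSeq a (suc s ℕ.+ t)) n
    ≡⟨ act-*ₚ (X- a) ((X- a) ^ₚ s) _ n ⟩
  act (X- a) (act ((X- a) ^ₚ s) (binomialSeq a (suc (s ℕ.+ t)))) n
    ≡⟨ act-cong (X- a) inner n ⟩
  act (X- a) (binomialSeq a (suc t)) n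
    ≡⟨ act[X-a]-binomialSeq-suc a t n ⟩
  binomialSeq a t n ∎
  where
  open ≡-Reasoning
  inner : act ((X- a) ^ₚ s) (binomialSeq a (suc (s ℕ.+ t))) ≗ binomialSeq a (suc t)
  inner = subst (λ u → act ((X- a) ^ₚ s) (binomialSeq a u) ≗ binomialSeq a (suc t))
                (ℕₚ.+-suc s t) (act[X-a]^s-binomialSeq a s (suc t))

binomialSeq-annihilated : ∀ a t → act ((X- a) ^ₚ suc t) (binomialSeq a t) ≗ λ _ → 0ℤ
binomialSeq-annihilated a t n = begin
  act ((X- a) *ₚ (X- a) ^ₚ t) (binomialSeq a t) n
    ≡⟨ act-*ₚ (X- a) ((X- a) ^ₚ t) _ n ⟩
  act (X- a) (act ((X- a) ^ₚ t) (binomialSeq a t)) n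
    ≡⟨ act-cong (X- a) inner n ⟩
  act (X- a) (binomialSeq a 0) n
    ≡⟨ act[X-a]-binomialSeq-zero a n ⟩
  0ℤ ∎
  where
  open ≡-Reasoning
  inner : act ((X- a) ^ₚ t) (binomialSeq a t) ≗ binomialSeq a 0
  inner = subst (λ u → act ((X- a) ^ₚ t) (binomialSeq a u) ≗ binomialSeq a 0)
                (ℕₚ.+-identityʳ t) (act[X-a]^s-binomialSeq a t 0)

rising : ℤ → ℕ → ℤ
rising n zero    = 1ℤ
rising n (suc t) = n * rising (1ℤ + n) t

rising-suc : ∀ n t → rising n (suc t) ≡ rising n t * (n + + t)
rising-suc n zero    = trans (ℤₚ.*-identityʳ n) (sym (trans (ℤₚ.*-identityˡ _) (ℤₚ.+-identityʳ n)))
rising-suc n (suc t) = begin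
  n * rising (1ℤ + n) (suc t)             ≡⟨ cong (_*_ n) (rising-suc (1ℤ + n) t) ⟩
  n * (rising (1ℤ + n) t * (1ℤ + n + + t)) ≡⟨ regroup n (rising (1ℤ + n) t) (+ t) ⟩
  n * rising (1ℤ + n) t * (n + + suc t)   ∎
  where
  open ≡-Reasoning
  regroup : ∀ n r t → n * (r * (1ℤ + n + t)) ≡ n * r * (n + (1ℤ + t))
  regroup = solve-∀

rising-one : ∀ t → rising 1ℤ t ≡ + (t !)
rising-one zero    = refl
rising-one (suc t) = begin
  rising 1ℤ (suc t)      ≡⟨ rising-suc 1ℤ t ⟩
  rising 1ℤ t * + suc t  ≡⟨ cong (_* + suc t) (rising-one t) ⟩
  + (t !) * + suc t      ≡⟨ ℤₚ.*-comm (+ (t !)) (+ suc t) ⟩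
  + suc t * + (t !)      ≡⟨ ℤₚ.pos-* (suc t) (t !) ⟨
  + (suc t !)            ∎
  where open ≡-Reasoning

rising-nonZero : ∀ n t → rising (+ suc n) t ≢ 0ℤ
rising-nonZero n zero    ()
rising-nonZero n (suc t) eq with ℤₚ.i*j≡0⇒i≡0∨j≡0 (+ suc n) eq
... | inj₁ ()
... | inj₂ r≡0 = rising-nonZero (suc n) t r≡0

binomialSeq-closedForm : ∀ a t M → + (t !) * binomialSeq a t (M ℕ.+ t) ≡ rising (+ suc M) t * a ^ M
binomialSeq-closedForm a zero    M = cong (λ m → 1ℤ * a ^ m) (ℕₚ.+-identityʳ M)
binomialSeq-closedForm a (suc t) zero = begin
  + (suc t !) * binomialSeq a (suc t) (suc t) ≡⟨ cong (_*_ (+ (suc t !))) (binomialSeq-diagonal a (suc t)) ⟩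
  + (suc t !) * 1ℤ                            ≡⟨ cong (_* 1ℤ) (rising-one (suc t)) ⟨
  rising 1ℤ (suc t) * 1ℤ                      ∎
  where open ≡-Reasoning
binomialSeq-closedForm a (suc t) (suc M) = begin
  + (suc t !) * (Y₁ + a * Y₂)
    ≡⟨ cong (λ f → f * (Y₁ + a * Y₂)) (ℤₚ.pos-* (suc t) (t !)) ⟩
  + suc t * + (t !) * (Y₁ + a * Y₂)
    ≡⟨ distribute (+ suc t) (+ (t !)) a Y₁ Y₂ ⟩
  + suc t * (+ (t !) * Y₁) + a * (+ suc t * + (t !) * Y₂)
    ≡⟨ cong₂ (λ u v → + suc t * u + a * (v * Y₂)) shifted-IH (ℤₚ.pos-* (suc t) (t !)) ⟨
  + suc t * (+ (t !) * binomialSeq a t (suc M ℕ.+ t)) + a * (+ (suc t !) * Y₂)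
    ≡⟨ cong₂ (λ u v → + suc t * u + a * v)
             (binomialSeq-closedForm a t (suc M)) (binomialSeq-closedForm a (suc t) M) ⟩
  + suc t * (r * a ^ suc M) + a * (+ suc M * r * a ^ M)
    ≡⟨ collect (+ t) (+ M) r a (a ^ M) ⟩
  r * (+ suc (suc M) + + t) * a ^ suc M
    ≡⟨ cong (_* a ^ suc M) (rising-suc (+ suc (suc M)) t) ⟨
  rising (+ suc (suc M)) (suc t) * a ^ suc M ∎
  where
  open ≡-Reasoning
  Y₁ Y₂ r : ℤ
  Y₁ = binomialSeq a t (M ℕ.+ suc t)
  Y₂ = binomialSeq a (suc t) (M ℕ.+ suc t)
  r  = rising (+ suc (suc M)) t
  shifted-IH : + (t !) * binomialSeq a t (suc M ℕ.+ t) ≡ + (t !) * Y₁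
  shifted-IH = cong (λ m → + (t !) * binomialSeq a t m) (sym (ℕₚ.+-suc M t))
  distribute : ∀ s f a y z → s * f * (y + a * z) ≡ s * (f * y) + a * (s * f * z)
  distribute = solve-∀
  collect : ∀ t m r a u →
    (1ℤ + t) * (r * (a * u)) + a * ((1ℤ + m) * r * u) ≡ r * (1ℤ + (1ℤ + m) + t) * (a * u)
  collect = solve-∀

-- Linear recurrences

sumUpTo : (ℕ → ℤ) → ℕ → ℤ
sumUpTo h k = sumℤ (applyUpTo h k)

sumUpTo-cong : ∀ k {h g} → (∀ i → i < k → h i ≡ g i) → sumUpTo h k ≡ sumUpTo g k
sumUpTo-cong zero    h≡g = refl
sumUpTo-cong (suc k) h≡g = cong₂ _+_ (h≡g 0 (s≤s z≤n)) (sumUpTo-cong k (λ i i<k → h≡g (suc i) (s≤s i<k)))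

sumUpTo-suc : ∀ k h → sumUpTo h (suc k) ≡ sumUpTo h k + h k
sumUpTo-suc zero    h = trans (ℤₚ.+-identityʳ (h 0)) (sym (ℤₚ.+-identityˡ (h 0)))
sumUpTo-suc (suc k) h = trans (cong (_+_ (h 0)) (sumUpTo-suc k (h ∘ suc))) (sym (ℤₚ.+-assoc (h 0) _ _))

sumUpTo-reverse : ∀ k h → sumUpTo h k ≡ sumUpTo (λ i → h (k ∸ suc i)) k
sumUpTo-reverse zero    h = refl
sumUpTo-reverse (suc k) h = begin
  sumUpTo h (suc k)                         ≡⟨ sumUpTo-suc k h ⟩
  sumUpTo h k + h k                         ≡⟨ ℤₚ.+-comm _ (h k) ⟩
  h k + sumUpTo h k                         ≡⟨ cong (_+_ (h k)) (sumUpTo-reverse k h) ⟩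
  h k + sumUpTo (λ i → h (k ∸ suc i)) k     ∎
  where open ≡-Reasoning

sumUpTo-neg : ∀ k h → sumUpTo (λ i → - h i) k ≡ - sumUpTo h k
sumUpTo-neg zero    h = refl
sumUpTo-neg (suc k) h =
  trans (cong (_+_ (- h 0)) (sumUpTo-neg k (h ∘ suc))) (sym (ℤₚ.neg-distrib-+ (h 0) _))

act-applyUpTo-++ : ∀ k g R f n →
  act (applyUpTo g k ++ R) f n ≡ sumUpTo (λ i → g i * f (n ℕ.+ i)) k + act R f (n ℕ.+ k)
act-applyUpTo-++ zero    g R f n =
  trans (cong (act R f) (sym (ℕₚ.+-identityʳ n))) (sym (ℤₚ.+-identityˡ _))
act-applyUpTo-++ (suc k) g R f n = begin
  g 0 * f n + act (applyUpTo (g ∘ suc) k ++ R) f (suc n)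
    ≡⟨ cong (_+_ (g 0 * f n)) (act-applyUpTo-++ k (g ∘ suc) R f (suc n)) ⟩
  g 0 * f n + (sumUpTo (λ i → g (suc i) * f (suc n ℕ.+ i)) k + act R f (suc n ℕ.+ k))
    ≡⟨ ℤₚ.+-assoc (g 0 * f n) _ _ ⟨
  g 0 * f n + sumUpTo (λ i → g (suc i) * f (suc n ℕ.+ i)) k + act R f (suc n ℕ.+ k)
    ≡⟨ cong₂ _+_ (cong₂ _+_ (cong (λ m → g 0 * f m) (sym (ℕₚ.+-identityʳ n)))
                             (sumUpTo-cong k (λ i _ → cong (λ m → g (suc i) * f m) (sym (ℕₚ.+-suc n i)))))
                 (cong (act R f) (sym (ℕₚ.+-suc n k))) ⟩
  sumUpTo (λ i → g i * f (n ℕ.+ i)) (suc k) + act R f (n ℕ.+ suc k) ∎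
  where open ≡-Reasoning

recurrenceSum : ℕ → (ℕ → ℤ) → (ℕ → ℤ) → ℕ → ℤ
recurrenceSum k b f n = sumℤ (map (λ i → b (suc i) * f (n ∸ suc i)) (upTo k))

recurrenceSum-reversed : ∀ k b f n →
  recurrenceSum k b f (n ℕ.+ k) ≡ sumUpTo (λ i → b (k ∸ i) * f (n ℕ.+ i)) k
recurrenceSum-reversed k b f n = begin
  recurrenceSum k b f (n ℕ.+ k)
    ≡⟨ cong sumℤ (Listₚ.map-upTo _ k) ⟩
  sumUpTo (λ i → b (suc i) * f (n ℕ.+ k ∸ suc i)) k
    ≡⟨ sumUpTo-reverse k _ ⟩
  sumUpTo (λ i → b (suc (k ∸ suc i)) * f (n ℕ.+ k ∸ suc (k ∸ suc i))) k
    ≡⟨ sumUpTo-cong k (λ i i<k → cong (λ j → b j * f (n ℕ.+ k ∸ j)) (sym (ℕₚ.+-∸-assoc 1 i<k))) ⟩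
  sumUpTo (λ i → b (k ∸ i) * f (n ℕ.+ k ∸ (k ∸ i))) k
    ≡⟨ sumUpTo-cong k (λ i i<k → cong (λ m → b (k ∸ i) * f m) (n+k∸[k∸i]≡n+i (ℕₚ.<⇒≤ i<k))) ⟩
  sumUpTo (λ i → b (k ∸ i) * f (n ℕ.+ i)) k ∎
  where
  open ≡-Reasoning
  n+k∸[k∸i]≡n+i : ∀ {i} → i ≤ k → n ℕ.+ k ∸ (k ∸ i) ≡ n ℕ.+ i
  n+k∸[k∸i]≡n+i {i} i≤k = trans (ℕₚ.+-∸-assoc n (ℕₚ.m∸n≤m k i)) (cong (n ℕ.+_) (ℕₚ.m∸[m∸n]≡n i≤k))

act-charPoly : ∀ k b f n → act (charPoly k b) f n ≡ f (n ℕ.+ k) - recurrenceSum k b f (n ℕ.+ k)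
act-charPoly k b f n = begin
  act (map (λ j → - b (k ∸ j)) (upTo k) ++ [ 1ℤ ]) f n
    ≡⟨ cong (λ cs → act (cs ++ [ 1ℤ ]) f n) (Listₚ.map-upTo _ k) ⟩
  act (applyUpTo (λ j → - b (k ∸ j)) k ++ [ 1ℤ ]) f n
    ≡⟨ act-applyUpTo-++ k _ [ 1ℤ ] f n ⟩
  sumUpTo (λ i → - b (k ∸ i) * f (n ℕ.+ i)) k + act [ 1ℤ ] f (n ℕ.+ k)
    ≡⟨ cong₂ _+_ (sumUpTo-cong k (λ i _ → sym (ℤₚ.neg-distribˡ-* (b (k ∸ i)) _))) (act-[1] f (n ℕ.+ k)) ⟩
  sumUpTo (λ i → - (b (k ∸ i) * f (n ℕ.+ i))) k + f (n ℕ.+ k)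
    ≡⟨ cong (_+ f (n ℕ.+ k)) (sumUpTo-neg k _) ⟩
  - sumUpTo (λ i → b (k ∸ i) * f (n ℕ.+ i)) k + f (n ℕ.+ k)
    ≡⟨ cong (λ s → - s + f (n ℕ.+ k)) (recurrenceSum-reversed k b f n) ⟨
  - recurrenceSum k b f (n ℕ.+ k) + f (n ℕ.+ k)
    ≡⟨ ℤₚ.+-comm _ (f (n ℕ.+ k)) ⟩
  f (n ℕ.+ k) - recurrenceSum k b f (n ℕ.+ k) ∎
  where open ≡-Reasoning

annihilated⇒Recurrence : ∀ k b f → (∀ n → act (charPoly k b) f n ≡ 0ℤ) → Recurrence k b f
annihilated⇒Recurrence k b f annihilated n k≤n =
  subst (λ m → f m ≡ recurrenceSum k b f m) (ℕₚ.m∸n+n≡m k≤n)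
    (ℤₚ.i-j≡0⇒i≡j _ _ (trans (sym (act-charPoly k b f (n ∸ k))) (annihilated (n ∸ k))))

recurrenceSum-cong : ∀ k b {f g} n → (∀ i → i < k → f (n ∸ suc i) ≡ g (n ∸ suc i)) →
  recurrenceSum k b f n ≡ recurrenceSum k b g n
recurrenceSum-cong k b {f} {g} n f≡g = begin
  recurrenceSum k b f n
    ≡⟨ cong sumℤ (Listₚ.map-upTo _ k) ⟩
  sumUpTo (λ i → b (suc i) * f (n ∸ suc i)) k
    ≡⟨ sumUpTo-cong k (λ i i<k → cong (_*_ (b (suc i))) (f≡g i i<k)) ⟩
  sumUpTo (λ i → b (suc i) * g (n ∸ suc i)) k
    ≡⟨ cong sumℤ (Listₚ.map-upTo _ k) ⟨
  recurrenceSum k b g n ∎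
  where open ≡-Reasoning

Recurrence-unique : ∀ k b {x y} → Recurrence k b x → Recurrence k b y →
  (∀ i → i < k → x i ≡ y i) → x ≗ y
Recurrence-unique k b {x} {y} rec-x rec-y initial = <-rec (λ n → x n ≡ y n) step
  where
  step : ∀ n → (∀ {m} → m < n → x m ≡ y m) → x n ≡ y n
  step n earlier with n ℕ.<? k
  ... | yes n<k = initial n n<k
  ... | no  n≮k = begin
    x n                   ≡⟨ rec-x n k≤n ⟩
    recurrenceSum k b x n ≡⟨ recurrenceSum-cong k b {x} {y} n (λ i i<k → earlier (n∸suc[i]<n i<k)) ⟩
    recurrenceSum k b y n ≡⟨ rec-y n k≤n ⟨
    y n                   ∎
    where
    open ≡-Reasoning
    k≤n : k ≤ n
    k≤n = ℕₚ.≮⇒≥ n≮k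
    n∸suc[i]<n : ∀ {i} → i < k → n ∸ suc i < n
    n∸suc[i]<n i<k = ℕₚ.∸-monoʳ-< {o = 0} (s≤s z≤n) (ℕₚ.≤-trans i<k k≤n)

Recurrence-closedForm : ∀ t b x a → Recurrence (suc t) b x → InitialValues (suc t) x →
  charPoly (suc t) b ≡ (X- a) ^ₚ suc t → x ≗ binomialSeq a t
Recurrence-closedForm t b x a rec-x (x-zeros , x-one) charPoly≡ =
  Recurrence-unique (suc t) b rec-x rec-binomialSeq initial
  where
  rec-binomialSeq : Recurrence (suc t) b (binomialSeq a t)
  rec-binomialSeq = annihilated⇒Recurrence (suc t) b (binomialSeq a t)
    (λ n → trans (cong (λ P → act P (binomialSeq a t) n) charPoly≡) (binomialSeq-annihilated a t n))
  initial : ∀ i → i < suc t → x i ≡ binomialSeq a t i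
  initial i (s≤s i≤t) with ℕₚ.m≤n⇒m<n∨m≡n i≤t
  ... | inj₁ i<t  = trans (x-zeros i (s≤s i<t)) (sym (binomialSeq-below a i<t))
  ... | inj₂ refl = trans x-one (sym (binomialSeq-diagonal a t))

Recurrence-scaledClosedForm : ∀ j b x a → Recurrence (suc (suc j)) b x → InitialValues (suc (suc j)) x →
  charPoly (suc (suc j)) b ≡ (X- a) ^ₚ suc (suc j) →
  ∀ N → + (suc j !) * a * x (N ℕ.+ j) ≡ + N * rising (1ℤ + + N) j * a ^ N
Recurrence-scaledClosedForm j b x a rec-x initial@(x-zeros , _) charPoly≡ zero =
  trans (cong (_*_ (+ (suc j !) * a)) (x-zeros j ℕₚ.≤-refl)) (ℤₚ.*-zeroʳ (+ (suc j !) * a))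
Recurrence-scaledClosedForm j b x a rec-x initial charPoly≡ (suc M) = begin
  c * x (suc M ℕ.+ j)                                     ≡⟨ cong (λ i → c * x i) (ℕₚ.+-suc M j) ⟨
  c * x (M ℕ.+ suc j)                                     ≡⟨ cong (_*_ c) x≡binomialSeq ⟩
  + (suc j !) * a * binomialSeq a (suc j) (M ℕ.+ suc j)   ≡⟨ pull-a (+ (suc j !)) a _ ⟩
  a * (+ (suc j !) * binomialSeq a (suc j) (M ℕ.+ suc j)) ≡⟨ cong (_*_ a) (binomialSeq-closedForm a (suc j) M) ⟩
  a * (g * a ^ M)                                         ≡⟨ push-a a g (a ^ M) ⟩
  g * a ^ suc M                                           ∎
  where
  open ≡-Reasoning
  c g : ℤ
  c = + (suc j !) * a
  g = + suc M * rising (+ suc (suc M)) j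
  x≡binomialSeq : x (M ℕ.+ suc j) ≡ binomialSeq a (suc j) (M ℕ.+ suc j)
  x≡binomialSeq = Recurrence-closedForm (suc j) b x a rec-x initial charPoly≡ (M ℕ.+ suc j)
  pull-a : ∀ f a y → f * a * y ≡ a * (f * y)
  pull-a = solve-∀
  push-a : ∀ a g u → a * (g * u) ≡ g * (a * u)
  push-a = solve-∀

-- Congruences modulo P

infix 4 _≡_mod_
record _≡_mod_ (x y : ℤ) (P : ℕ) : Set where
  constructor congruent
  field
    divides-difference : + P ℤ∣.∣ x - y

≡-mod-refl : ∀ {x P} → x ≡ x mod P
≡-mod-refl {x} = congruent (ℤ∣.divides 0ℤ (ℤₚ.+-inverseʳ x))

≡-mod-sym : ∀ {x y P} → x ≡ y mod P → y ≡ x mod P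
≡-mod-sym {x} {y} (congruent x≡y) = congruent (subst (_ ℤ∣.∣_) (negate x y) (ℤ∣.∣m⇒∣-m x≡y))
  where
  negate : ∀ x y → - (x - y) ≡ y - x
  negate = solve-∀

≡-mod-trans : ∀ {x y z P} → x ≡ y mod P → y ≡ z mod P → x ≡ z mod P
≡-mod-trans {x} {y} {z} (congruent x≡y) (congruent y≡z) =
  congruent (subst (_ ℤ∣.∣_) (ℤₚ.+-minus-telescope x y z) (ℤ∣.∣m∣n⇒∣m+n x≡y y≡z))

+-cong-mod : ∀ {x y u v P} → x ≡ y mod P → u ≡ v mod P → x + u ≡ y + v mod P
+-cong-mod {x} {y} {u} {v} (congruent x≡y) (congruent u≡v) =
  congruent (subst (_ ℤ∣.∣_) (regroup x y u v) (ℤ∣.∣m∣n⇒∣m+n x≡y u≡v))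
  where
  regroup : ∀ x y u v → (x - y) + (u - v) ≡ x + u - (y + v)
  regroup = solve-∀

*-cong-mod : ∀ {x y u v P} → x ≡ y mod P → u ≡ v mod P → x * u ≡ y * v mod P
*-cong-mod {x} {y} {u} {v} (congruent x≡y) (congruent u≡v) =
  congruent (subst (_ ℤ∣.∣_) (regroup x y u v) (ℤ∣.∣m∣n⇒∣m+n (ℤ∣.∣m⇒∣m*n u x≡y) (ℤ∣.∣n⇒∣m*n y u≡v)))
  where
  regroup : ∀ x y u v → (x - y) * u + y * (u - v) ≡ x * u - y * v
  regroup = solve-∀

^-cong-mod : ∀ {x y P} n → x ≡ y mod P → x ^ n ≡ y ^ n mod P
^-cong-mod zero    x≡y = ≡-mod-refl
^-cong-mod (suc n) x≡y = *-cong-mod x≡y (^-cong-mod n x≡y)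

rising-cong-mod : ∀ {u v P} t → u ≡ v mod P → rising u t ≡ rising v t mod P
rising-cong-mod                 zero    u≡v = ≡-mod-refl
rising-cong-mod {u} {v} {P} (suc t) u≡v =
  *-cong-mod u≡v (rising-cong-mod {1ℤ + u} {1ℤ + v} t (+-cong-mod (≡-mod-refl {1ℤ}) u≡v))

≡-mod-weaken : ∀ {x y P Q} → Q ∣ℕ P → x ≡ y mod P → x ≡ y mod Q
≡-mod-weaken Q∣P (congruent P∣x-y) = congruent (ℤ∣.∣-trans (ℤ∣.∣ᵤ⇒∣ Q∣P) P∣x-y)

∣⇒≡0-mod : ∀ {P N} → P ∣ℕ N → + N ≡ 0ℤ mod P
∣⇒≡0-mod {P} {N} P∣N = congruent (subst (+ P ℤ∣.∣_) (sym (ℤₚ.+-identityʳ (+ N))) (ℤ∣.∣ᵤ⇒∣ P∣N))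

rising[1+N]≡j!-mod : ∀ j {P N} → P ∣ℕ N → rising (1ℤ + + N) j ≡ + (j !) mod P
rising[1+N]≡j!-mod j {P} {N} P∣N = subst (λ z → rising (1ℤ + + N) j ≡ z mod P) (rising-one j)
  (rising-cong-mod {1ℤ + + N} {1ℤ + 0ℤ} j (+-cong-mod (≡-mod-refl {1ℤ}) (∣⇒≡0-mod P∣N)))

%ℕ-≡⇒≡-mod : ∀ x y P .{{_ : ℕ.NonZero P}} → x %ℕ P ≡ y %ℕ P → x ≡ y mod P
%ℕ-≡⇒≡-mod x y P x%P≡y%P = congruent (ℤ∣.divides (x /ℕ P - y /ℕ P) (begin
  x - y
    ≡⟨ cong₂ _-_ (ℤ÷.a≡a%ℕn+[a/ℕn]*n x P) (ℤ÷.a≡a%ℕn+[a/ℕn]*n y P) ⟩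
  (+ (x %ℕ P) + x /ℕ P * + P) - (+ (y %ℕ P) + y /ℕ P * + P)
    ≡⟨ cong (λ r → (+ (x %ℕ P) + x /ℕ P * + P) - (+ r + y /ℕ P * + P)) x%P≡y%P ⟨
  (+ (x %ℕ P) + x /ℕ P * + P) - (+ (x %ℕ P) + y /ℕ P * + P)
    ≡⟨ cancel (+ (x %ℕ P)) (x /ℕ P) (y /ℕ P) (+ P) ⟩
  (x /ℕ P - y /ℕ P) * + P ∎))
  where
  open ≡-Reasoning
  cancel : ∀ r u v P → (r + u * P) - (r + v * P) ≡ (u - v) * P
  cancel = solve-∀

+-remainder-≡-mod : ∀ x y P .{{_ : ℕ.NonZero P}} → x + + ((y - x) %ℕ P) ≡ y mod P
+-remainder-≡-mod x y P = congruent (ℤ∣.divides (- ((y - x) /ℕ P)) (begin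
  x + + r - y             ≡⟨ swap x y (+ r) ⟩
  + r - (y - x)           ≡⟨ cong (_-_ (+ r)) (ℤ÷.a≡a%ℕn+[a/ℕn]*n (y - x) P) ⟩
  + r - (+ r + q * + P)   ≡⟨ cancel (+ r) q (+ P) ⟩
  - q * + P               ∎))
  where
  open ≡-Reasoning
  r : ℕ
  r = (y - x) %ℕ P
  q : ℤ
  q = (y - x) /ℕ P
  swap : ∀ x y r → x + r - y ≡ r - (y - x)
  swap = solve-∀
  cancel : ∀ r q P → r - (r + q * P) ≡ - q * P
  cancel = solve-∀

powers-collide : ∀ a P .{{_ : ℕ.NonZero P}} → ∃ λ u → ∃ λ δ → a ^ u * a ^ suc δ ≡ a ^ u * 1ℤ mod P
powers-collide a P with Finₚ.pigeonhole (ℕₚ.n<1+n P) (λ i → fromℕ< (ℤ÷.n%ℕd<d (a ^ toℕ i) P))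
... | i , j , i<j , same-residue = u , δ , subst₂ (λ l r → l ≡ r mod P)
      (trans (cong (a ^_) j≡u+[1+δ]) (ℤₚ.^-distribˡ-+-* a u (suc δ))) (sym (ℤₚ.*-identityʳ (a ^ u)))
      (≡-mod-sym a^u≡a^j)
  where
  u δ : ℕ
  u = toℕ i
  δ = toℕ j ∸ suc u
  j≡u+[1+δ] : toℕ j ≡ u ℕ.+ suc δ
  j≡u+[1+δ] = trans (sym (ℕₚ.m+[n∸m]≡n (ℕₚ.<⇒≤ i<j))) (cong (u ℕ.+_) (ℕₚ.+-∸-assoc 1 i<j))
  a^u≡a^j : a ^ u ≡ a ^ toℕ j mod P
  a^u≡a^j = %ℕ-≡⇒≡-mod (a ^ u) (a ^ toℕ j) P
    (trans (sym (Finₚ.toℕ-fromℕ< _)) (trans (cong toℕ same-residue) (Finₚ.toℕ-fromℕ< _)))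

-- Fractions

-- r ≐ n / d: the possibly unreduced fraction n/d represents r.
infix 4 _≐_/_
data _≐_/_ (r : ℚ) (n d : ℤ) : Set where
  *≡* : ↥ r * d ≡ n * ↧ r → r ≐ n / d

≐-rescale : ∀ {r n d n′ d′} .{{_ : ℤ.NonZero d}} → r ≐ n / d → n * d′ ≡ n′ * d → r ≐ n′ / d′
≐-rescale {r} {n} {d} {n′} {d′} (*≡* r≐n/d) nd′≡n′d = *≡* (ℤₚ.*-cancelʳ-≡ (↥ r * d′) (n′ * ↧ r) d (begin
  ↥ r * d′ * d     ≡⟨ swap (↥ r) d′ d ⟩
  ↥ r * d * d′     ≡⟨ cong (_* d′) r≐n/d ⟩
  n * ↧ r * d′     ≡⟨ swap n (↧ r) d′ ⟩
  n * d′ * ↧ r     ≡⟨ cong (_* ↧ r) nd′≡n′d ⟩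
  n′ * d * ↧ r     ≡⟨ swap n′ d (↧ r) ⟩
  n′ * ↧ r * d     ∎))
  where
  open ≡-Reasoning
  swap : ∀ x y z → x * y * z ≡ x * z * y
  swap = solve-∀

toℚᵘ-≃⇒≐ : ∀ r {U} → ℚ.toℚᵘ r ≃ᵘ U → r ≐ ↥ᵘ U / ↧ᵘ U
toℚᵘ-≃⇒≐ (mkℚ _ _ _) (*≡* eq) = *≡* eq

≐-+ : ∀ u v → u ℚ.+ v ≐ (↥ u * ↧ v + ↥ v * ↧ u) / (↧ u * ↧ v)
≐-+ u@(mkℚ _ _ _) v@(mkℚ _ _ _) = toℚᵘ-≃⇒≐ (u ℚ.+ v) (ℚₚ.toℚᵘ-homo-+ u v)

≐-* : ∀ u v → u ℚ.* v ≐ (↥ u * ↥ v) / (↧ u * ↧ v)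
≐-* u@(mkℚ _ _ _) v@(mkℚ _ _ _) = toℚᵘ-≃⇒≐ (u ℚ.* v) (ℚₚ.toℚᵘ-homo-* u v)

≐-- : ∀ {u n d} v → u ≐ n / d → u ℚ.- v ≐ (n * ↧ v - ↥ v * d) / (d * ↧ v)
≐-- {u} {n} {d} v (*≡* u≐n/d) = ≐-rescale (subst₂ (λ a b → u ℚ.- v ≐ (↥ u * b + a * ↧ u) / (↧ u * b))
                                             (ℚₚ.↥-neg v) (ℚₚ.↧-neg v) (≐-+ u (ℚ.- v))) (begin
  (↥ u * ↧ v + - ↥ v * ↧ u) * (d * ↧ v)   ≡⟨ expand (↥ u) (↧ u) (↥ v) (↧ v) d ⟩
  ↥ u * d * (↧ v * ↧ v) - ↥ v * d * ↧ u * ↧ v ≡⟨ cong (λ z → z * (↧ v * ↧ v) - ↥ v * d * ↧ u * ↧ v) u≐n/d ⟩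
  n * ↧ u * (↧ v * ↧ v) - ↥ v * d * ↧ u * ↧ v ≡⟨ collect n (↧ u) (↥ v) (↧ v) d ⟩
  (n * ↧ v - ↥ v * d) * (↧ u * ↧ v)        ∎)
  where
  open ≡-Reasoning
  expand : ∀ a b c e d → (a * e + - c * b) * (d * e) ≡ a * d * (e * e) - c * d * b * e
  expand = solve-∀
  collect : ∀ n b c e d → n * b * (e * e) - c * d * b * e ≡ (n * e - c * d) * (b * e)
  collect = solve-∀

≐-÷ : ∀ u v .{{_ : ℚ.NonZero v}} → u ℚ.÷ v ≐ (↥ u * ↧ v) / (↧ u * ↥ v)
≐-÷ u v = *≡* (begin
  ↥ w * (↧ u * ↥ v)       ≡⟨ regroup (↥ w) (↧ u) (↥ v) ⟩
  ↥ w * ↥ v * ↧ u         ≡⟨ cross ⟨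
  ↥ u * (↧ w * ↧ v)       ≡⟨ regroup (↥ u) (↧ w) (↧ v) ⟩
  ↥ u * ↧ v * ↧ w         ∎)
  where
  open ≡-Reasoning
  w : ℚ
  w = u ℚ.÷ v
  w*v≡u : w ℚ.* v ≡ u
  w*v≡u = trans (ℚₚ.*-assoc u (ℚ.1/ v) v) (trans (cong (u ℚ.*_) (ℚₚ.*-inverseˡ v)) (ℚₚ.*-identityʳ u))
  cross : ↥ u * (↧ w * ↧ v) ≡ ↥ w * ↥ v * ↧ u
  cross with ≐-* w v
  ... | *≡* eq = subst (λ z → ↥ z * (↧ w * ↧ v) ≡ ↥ w * ↥ v * ↧ z) w*v≡u eq
  regroup : ∀ a b c → a * (b * c) ≡ a * c * b
  regroup = solve-∀

↥-fromℤ : ∀ z → ↥ fromℤ z ≡ z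
↥-fromℤ z = trans (sym (ℤₚ.*-identityʳ _)) (trans (cong (↥ fromℤ z *_) (sym (ℤgcd.gcd-zeroʳ z))) (ℚₚ.↥-/ z 1))

↧-fromℤ : ∀ z → ↧ fromℤ z ≡ 1ℤ
↧-fromℤ z = trans (sym (ℤₚ.*-identityʳ _)) (trans (cong (↧ fromℤ z *_) (sym (ℤgcd.gcd-zeroʳ z))) (ℚₚ.↧-/ z 1))

quot-≐ : ∀ x m n (x[n]≢0 : x n ≢ 0ℤ) → quot x m n x[n]≢0 ≐ x m / x n
quot-≐ x m n x[n]≢0 = subst₂ (λ a b → quot x m n x[n]≢0 ≐ a / b)
  (trans (cong₂ _*_ (↥-fromℤ (x m)) (↧-fromℤ (x n))) (ℤₚ.*-identityʳ (x m)))
  (trans (cong₂ _*_ (↧-fromℤ (x m)) (↥-fromℤ (x n))) (ℤₚ.*-identityˡ (x n)))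
  (≐-÷ (fromℤ (x m)) (fromℤ (x n)) {{ℚ.≢-nonZero (fromℤ-≢0 (x n) x[n]≢0)}})

coprime-↥-↧ : ∀ r → Coprime ∣ ↥ r ∣ (↧ₙ r)
coprime-↥-↧ (mkℚ _ _ c) = recompute c

-- Powers of a prime and p-adic smallness

module _ {p : ℕ} (p-prime : Prime p) where

  private instance
    p-nonZero : ℕ.NonZero p
    p-nonZero = prime⇒nonZero p-prime

  p≢1 : p ≢ 1
  p≢1 = ℕ.nonTrivial⇒≢1 {{prime⇒nonTrivial p-prime}}

  primePower-divisor : ∀ {m n} e → ¬ p ∣ℕ m → p ℕ.^ e ∣ℕ m ℕ.* n → p ℕ.^ e ∣ℕ n
  primePower-divisor {n = n} zero _ _ = ℕ∣.1∣ n
  primePower-divisor {m} (suc e) p∤m p^[1+e]∣mn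
    with euclidsLemma m _ p-prime (ℕ∣.∣-trans (ℕ∣.m∣m*n (p ℕ.^ e)) p^[1+e]∣mn)
  ... | inj₁ p∣m = ⊥-elim (p∤m p∣m)
  ... | inj₂ (divides n′ refl) =
    subst (p ℕ.^ suc e ∣ℕ_) (ℕₚ.*-comm p n′) (ℕ∣.*-monoʳ-∣ p p^e∣n′)
    where
    p^e∣n′ : p ℕ.^ e ∣ℕ n′
    p^e∣n′ = primePower-divisor e p∤m (ℕ∣.*-cancelˡ-∣ p
      (subst (p ℕ.^ suc e ∣ℕ_) (trans (sym (ℕₚ.*-assoc m n′ p)) (ℕₚ.*-comm (m ℕ.* n′) p)) p^[1+e]∣mn))

  primePowerSplit : ∀ n {{_ : ℕ.NonZero n}} → ∃ λ h → ∃ λ d → n ≡ p ℕ.^ h ℕ.* d × ¬ p ∣ℕ d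
  primePowerSplit n {{n≢0}} = <-rec Split step n n≢0
    where
    Split : ℕ → Set
    Split n = ℕ.NonZero n → ∃ λ h → ∃ λ d → n ≡ p ℕ.^ h ℕ.* d × ¬ p ∣ℕ d
    step : ∀ n → (∀ {m} → m < n → Split m) → Split n
    step n smaller n≢0 with p ℕ∣.∣? n
    ... | no  p∤n = 0 , n , sym (ℕₚ.+-identityʳ n) , p∤n
    ... | yes (divides q refl) with smaller q<qp q≢0
      where
      q≢0 : ℕ.NonZero q
      q≢0 = ℕ.≢-nonZero (λ q≡0 → ℕ.≢-nonZero⁻¹ (q ℕ.* p) {{n≢0}} (cong (ℕ._* p) q≡0))
      q<qp : q < q ℕ.* p
      q<qp = ℕₚ.m<m*n q p {{q≢0}} (ℕ.nonTrivial⇒n>1 p {{prime⇒nonTrivial p-prime}})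
    ... | h , d , refl , p∤d = suc h , d , regroup , p∤d
      where
      regroup : p ℕ.^ h ℕ.* d ℕ.* p ≡ p ℕ.* p ℕ.^ h ℕ.* d
      regroup = trans (ℕₚ.*-comm (p ℕ.^ h ℕ.* d) p) (sym (ℕₚ.*-assoc p (p ℕ.^ h) d))

  ∤-^ : ∀ {a} i → ¬ + p ∣ a → ¬ + p ∣ a ^ i
  ∤-^ zero    p∤a p∣1 = p≢1 (ℕ∣.∣1⇒≡1 p∣1)
  ∤-^ {a} (suc i) p∤a p∣a^[1+i]
    with euclidsLemma ∣ a ∣ ∣ a ^ i ∣ p-prime (subst (p ∣ℕ_) (ℤₚ.abs-* a (a ^ i)) p∣a^[1+i])
  ... | inj₁ p∣a   = p∤a p∣a
  ... | inj₂ p∣a^i = ∤-^ i p∤a p∣a^i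

  *-cancelˡ-mod-p^ : ∀ {c x y} T → ¬ + p ∣ c → c * x ≡ c * y mod p ℕ.^ T → x ≡ y mod p ℕ.^ T
  *-cancelˡ-mod-p^ {c} {x} {y} T p∤c (congruent p^T∣cx-cy) = congruent (ℤ∣.∣ᵤ⇒∣ (primePower-divisor T p∤c
    (subst (p ℕ.^ T ∣ℕ_) (ℤₚ.abs-* c (x - y)) (ℤ∣.∣⇒∣ᵤ (subst (_ ℤ∣.∣_) (factor c x y) p^T∣cx-cy)))))
    where
    factor : ∀ c x y → c * x - c * y ≡ c * (x - y)
    factor = solve-∀

  ∃-order : ∀ {a} → ¬ + p ∣ a → ∀ T → ∃ λ ρ → a ^ suc ρ ≡ 1ℤ mod p ℕ.^ T
  ∃-order {a} p∤a T =
    let u , δ , a^u*a^[1+δ]≡a^u = powers-collide a (p ℕ.^ T) {{ℕₚ.m^n≢0 p T}}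
    in  δ , *-cancelˡ-mod-p^ {a ^ u} T (∤-^ {a} u p∤a) a^u*a^[1+δ]≡a^u

  exactPrimePower-stable : ∀ {y} h d → y ≡ + (p ℕ.^ h ℕ.* d) mod p ℕ.^ suc h → ¬ p ∣ℕ d →
    ∃ λ d′ → y ≡ + (p ℕ.^ h) * d′ × ¬ + p ∣ d′
  exactPrimePower-stable {y} h d (congruent (ℤ∣.divides k y-c≡k*p^[1+h])) p∤d = + d + k * + p , y≡ , p∤d′
    where
    open ≡-Reasoning
    y≡ : y ≡ + (p ℕ.^ h) * (+ d + k * + p)
    y≡ = begin
      y                                         ≡⟨ subtract-add y (+ (p ℕ.^ h ℕ.* d)) ⟩
      y - + (p ℕ.^ h ℕ.* d) + + (p ℕ.^ h ℕ.* d) ≡⟨ cong₂ _+_ y-c≡k*p^[1+h] (ℤₚ.pos-* (p ℕ.^ h) d) ⟩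
      k * + (p ℕ.* p ℕ.^ h) + + (p ℕ.^ h) * + d
        ≡⟨ cong (λ z → k * z + + (p ℕ.^ h) * + d) (ℤₚ.pos-* p (p ℕ.^ h)) ⟩
      k * (+ p * + (p ℕ.^ h)) + + (p ℕ.^ h) * + d ≡⟨ factor k (+ p) (+ (p ℕ.^ h)) (+ d) ⟩
      + (p ℕ.^ h) * (+ d + k * + p)             ∎
      where
      subtract-add : ∀ y c → y ≡ y - c + c
      subtract-add = solve-∀
      factor : ∀ k p q d → k * (p * q) + q * d ≡ q * (d + k * p)
      factor = solve-∀
    p∤d′ : ¬ + p ∣ (+ d + k * + p)
    p∤d′ p∣d′ = p∤d (ℤ∣.∣⇒∣ᵤ {+ p} {+ d}
      (ℤ∣.∣m+n∣n⇒∣m (ℤ∣.∣ᵤ⇒∣ {+ p} {+ d + k * + p} p∣d′) (ℤ∣.∣n⇒∣m*n k ℤ∣.∣-refl)))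

  PAdicSmall-intro : ∀ {r n h d} e → r ≐ n / (+ (p ℕ.^ h) * d) → ¬ + p ∣ d →
    + (p ℕ.^ (h ℕ.+ e)) ∣ n → PAdicSmall p e r
  PAdicSmall-intro {r} {n} {h} {d} e (*≡* r≐n/p^hd) p∤d p^[h+e]∣n = p^e∣↥r , p∤↧r
    where
    instance
      p^h≢0 : ℕ.NonZero (p ℕ.^ h)
      p^h≢0 = ℕₚ.m^n≢0 p h
    cross : p ℕ.^ h ℕ.* (∣ d ∣ ℕ.* ∣ ↥ r ∣) ≡ ∣ n ∣ ℕ.* ↧ₙ r
    cross = begin
      p ℕ.^ h ℕ.* (∣ d ∣ ℕ.* ∣ ↥ r ∣)   ≡⟨ ℕₚ.*-assoc (p ℕ.^ h) ∣ d ∣ ∣ ↥ r ∣ ⟨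
      p ℕ.^ h ℕ.* ∣ d ∣ ℕ.* ∣ ↥ r ∣     ≡⟨ ℕₚ.*-comm (p ℕ.^ h ℕ.* ∣ d ∣) ∣ ↥ r ∣ ⟩
      ∣ ↥ r ∣ ℕ.* (p ℕ.^ h ℕ.* ∣ d ∣)   ≡⟨ cong (∣ ↥ r ∣ ℕ.*_) (ℤₚ.abs-* (+ (p ℕ.^ h)) d) ⟨
      ∣ ↥ r ∣ ℕ.* ∣ + (p ℕ.^ h) * d ∣   ≡⟨ ℤₚ.abs-* (↥ r) (+ (p ℕ.^ h) * d) ⟨
      ∣ ↥ r * (+ (p ℕ.^ h) * d) ∣       ≡⟨ cong ∣_∣ r≐n/p^hd ⟩
      ∣ n * ↧ r ∣                       ≡⟨ ℤₚ.abs-* n (↧ r) ⟩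
      ∣ n ∣ ℕ.* ↧ₙ r                    ∎
      where open ≡-Reasoning
    p^h∣n : p ℕ.^ h ∣ℕ ∣ n ∣
    p^h∣n = ℕ∣.∣-trans (subst (p ℕ.^ h ∣ℕ_) (sym (ℕₚ.^-distribˡ-+-* p h e)) (ℕ∣.m∣m*n (p ℕ.^ e))) p^[h+e]∣n
    cancel-p^h : ∀ {m} → p ℕ.^ h ℕ.* m ∣ℕ ∣ n ∣ ℕ.* ↧ₙ r → m ∣ℕ ∣ d ∣ ℕ.* ∣ ↥ r ∣
    cancel-p^h {m} p^hm∣nr = ℕ∣.*-cancelˡ-∣ (p ℕ.^ h) (subst (p ℕ.^ h ℕ.* m ∣ℕ_) (sym cross) p^hm∣nr)
    p^e∣↥r : p ℕ.^ e ∣ℕ ∣ ↥ r ∣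
    p^e∣↥r = primePower-divisor e p∤d (cancel-p^h
      (subst (_∣ℕ ∣ n ∣ ℕ.* ↧ₙ r) (ℕₚ.^-distribˡ-+-* p h e) (ℕ∣.∣m⇒∣m*n (↧ₙ r) p^[h+e]∣n)))
    p∤↧r : ¬ p ∣ℕ ↧ₙ r
    p∤↧r p∣↧r with euclidsLemma ∣ d ∣ ∣ ↥ r ∣ p-prime (cancel-p^h (ℕ∣.*-pres-∣ p^h∣n p∣↧r))
    ... | inj₁ p∣d  = p∤d p∣d
    ... | inj₂ p∣↥r = p≢1 (coprime-↥-↧ r (p∣↥r , p∣↧r))

-- Density of the quotient set

module _ {p : ℕ} (p-prime : Prime p) {a : ℤ} (p∤a : ¬ + p ∣ a)
  (x : ℕ → ℤ) (s : ℕ) (c : ℤ) .{{_ : ℤ.NonZero c}}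
  (Γ : ℕ → ℤ) (Γ≢0 : ∀ N → Γ N ≢ 0ℤ)
  (γ : ℕ) .{{_ : ℕ.NonZero γ}} (Γ≡γ : ∀ {P N} → P ∣ℕ N → Γ N ≡ + γ mod P)
  (x-closed : ∀ N → c * x (N ℕ.+ s) ≡ + N * Γ N * a ^ N)
  where

  private instance
    p≢0 : ℕ.NonZero p
    p≢0 = prime⇒nonZero p-prime

  module Witness (q : ℚ) (e h D : ℕ) (Bγ≡p^hD : ↧ₙ q ℕ.* γ ≡ p ℕ.^ h ℕ.* D) (p∤D : ¬ p ∣ℕ D)
                 (ρ′ : ℕ) (a^ρ≡1 : a ^ suc ρ′ ≡ 1ℤ mod p ℕ.^ suc (h ℕ.+ e)) where

    -- Nn and Nm play the roles of N = PρB and N′ = PρS, and d = N′ - N.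

    A : ℤ
    A = ↥ q
    B ρ P L : ℕ
    B = ↧ₙ q
    ρ = suc ρ′
    P = p ℕ.^ suc (h ℕ.+ e)
    L = P ℕ.* ρ

    instance
      P≢0 : ℕ.NonZero P
      P≢0 = ℕₚ.m^n≢0 p (suc (h ℕ.+ e))

    t S Nn Nm d n m : ℕ
    t = (A - + B) %ℕ P
    S = B ℕ.+ t
    Nn = L ℕ.* B
    Nm = L ℕ.* S
    d  = L ℕ.* t
    n = Nn ℕ.+ s
    m = Nm ℕ.+ s
    Gn Gm W : ℤ
    Gn = Γ Nn
    Gm = Γ Nm
    W = + S * a ^ d * Gm

    Nm≡Nn+d : Nm ≡ Nn ℕ.+ d
    Nm≡Nn+d = ℕₚ.*-distribˡ-+ L B t

    a^d≡1 : a ^ d ≡ 1ℤ mod P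
    a^d≡1 = subst₂ (λ u v → u ≡ v mod P)
      (trans (ℤₚ.^-*-assoc a ρ (P ℕ.* t)) (cong (a ^_) d≡ρ*[P*t])) (ℤₚ.^-zeroˡ (P ℕ.* t))
      (^-cong-mod (P ℕ.* t) a^ρ≡1)
      where
      d≡ρ*[P*t] : ρ ℕ.* (P ℕ.* t) ≡ d
      d≡ρ*[P*t] = trans (sym (ℕₚ.*-assoc ρ P t)) (cong (ℕ._* t) (ℕₚ.*-comm ρ P))

    S≡A : + S ≡ A mod P
    S≡A = +-remainder-≡-mod (+ B) A P

    P∣L : P ∣ℕ L
    P∣L = ℕ∣.m∣m*n ρ

    W≡A*Gn : W ≡ A * Gn mod P
    W≡A*Gn = ≡-mod-trans {y = A * + γ}
      (subst (λ z → W ≡ z mod P) (cong (_* + γ) (ℤₚ.*-identityʳ A))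
        (*-cong-mod (*-cong-mod S≡A a^d≡1) (Γ≡γ (ℕ∣.∣m⇒∣m*n S P∣L))))
      (≡-mod-sym (*-cong-mod (≡-mod-refl {A}) (Γ≡γ (ℕ∣.∣m⇒∣m*n B P∣L))))

    cross : x m * (+ B * Gn) ≡ x n * W
    cross = ℤₚ.*-cancelˡ-≡ c _ _ (begin
      c * (x m * (+ B * Gn))                       ≡⟨ ℤₚ.*-assoc c (x m) _ ⟨
      c * x m * (+ B * Gn)                         ≡⟨ cong (_* (+ B * Gn)) (x-closed Nm) ⟩
      + Nm * Gm * a ^ Nm * (+ B * Gn)              ≡⟨ cong₂ (λ u v → u * Gm * v * (+ B * Gn)) (ℤₚ.pos-* L S)
                                                        (trans (cong (a ^_) Nm≡Nn+d) (ℤₚ.^-distribˡ-+-* a Nn d)) ⟩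
      + L * + S * Gm * (a ^ Nn * a ^ d) * (+ B * Gn) ≡⟨ regroup (+ L) (+ S) Gm (a ^ Nn) (a ^ d) (+ B) Gn ⟩
      + L * + B * Gn * a ^ Nn * W                  ≡⟨ cong (λ u → u * Gn * a ^ Nn * W) (ℤₚ.pos-* L B) ⟨
      + Nn * Gn * a ^ Nn * W                       ≡⟨ cong (_* W) (x-closed Nn) ⟨
      c * x n * W                                  ≡⟨ ℤₚ.*-assoc c (x n) W ⟩
      c * (x n * W)                                ∎)
      where
      open ≡-Reasoning
      regroup : ∀ l s g an ad b h → l * s * g * (an * ad) * (b * h) ≡ l * b * h * an * (s * ad * g)
      regroup = solve-∀

    x[n]≢0 : x n ≢ 0ℤ
    x[n]≢0 x[n]≡0 with ℤₚ.i*j≡0⇒i≡0∨j≡0 (+ Nn * Gn)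
                         (trans (sym (x-closed Nn)) (trans (cong (c *_) x[n]≡0) (ℤₚ.*-zeroʳ c)))
    ... | inj₂ a^Nn≡0 = p∤a (subst (λ z → + p ∣ z) (sym (ℤₚ.i^n≡0⇒i≡0 a Nn a^Nn≡0)) (ℕ∣._∣0 p))
    ... | inj₁ Nn*Gn≡0 with ℤₚ.i*j≡0⇒i≡0∨j≡0 (+ Nn) Nn*Gn≡0
    ...   | inj₁ Nn≡0 = ℕ.≢-nonZero⁻¹ Nn {{Nn≢0}} (ℤₚ.+-injective Nn≡0)
      where
      Nn≢0 : ℕ.NonZero Nn
      Nn≢0 = ℕₚ.m*n≢0 L B {{ℕₚ.m*n≢0 P ρ}}
    ...   | inj₂ Gn≡0 = Γ≢0 Nn Gn≡0

    p^[1+h]∣P : p ℕ.^ suc h ∣ℕ P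
    p^[1+h]∣P = subst (p ℕ.^ suc h ∣ℕ_) (sym (ℕₚ.^-distribˡ-+-* p (suc h) e)) (ℕ∣.m∣m*n (p ℕ.^ e))

    B*Gn≡p^hD : + B * Gn ≡ + (p ℕ.^ h ℕ.* D) mod p ℕ.^ suc h
    B*Gn≡p^hD = ≡-mod-weaken p^[1+h]∣P
      (subst (λ z → + B * Gn ≡ z mod P) (trans (sym (ℤₚ.pos-* B γ)) (cong +_ Bγ≡p^hD))
        (*-cong-mod (≡-mod-refl {+ B}) (Γ≡γ (ℕ∣.∣m⇒∣m*n B P∣L))))

    p^[h+e]∣W-A*Gn : + (p ℕ.^ (h ℕ.+ e)) ∣ (W - A * Gn)
    p^[h+e]∣W-A*Gn = ℕ∣.∣-trans (ℕ∣.n∣m*n p) (ℤ∣.∣⇒∣ᵤ (_≡_mod_.divides-difference W≡A*Gn))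

    instance
      x[n]*B≢0 : ℤ.NonZero (x n * ↧ q)
      x[n]*B≢0 = ℤₚ.i*j≢0 (x n) (↧ q) {{ℤ.≢-nonZero x[n]≢0}}

    quot-q≐ : ∀ d′ → + B * Gn ≡ + (p ℕ.^ h) * d′ → quot x m n x[n]≢0 ℚ.- q ≐ (W - A * Gn) / (+ (p ℕ.^ h) * d′)
    quot-q≐ d′ B*Gn≡p^h*d′ = ≐-rescale (≐-- q (quot-≐ x m n x[n]≢0)) (begin
        (x m * + B - A * x n) * (+ (p ℕ.^ h) * d′)        ≡⟨ cong (_*_ (x m * + B - A * x n)) B*Gn≡p^h*d′ ⟨
        (x m * + B - A * x n) * (+ B * Gn)                ≡⟨ expand (x m) (+ B) A (x n) Gn ⟩
        + B * (x m * (+ B * Gn)) - A * x n * (+ B * Gn)   ≡⟨ cong (λ z → + B * z - A * x n * (+ B * Gn)) cross ⟩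
        + B * (x n * W) - A * x n * (+ B * Gn)            ≡⟨ collect (x n) (+ B) A W Gn ⟩
        (W - A * Gn) * (x n * + B)                        ∎)
        where
        open ≡-Reasoning
        expand : ∀ xm b a xn g → (xm * b - a * xn) * (b * g) ≡ b * (xm * (b * g)) - a * xn * (b * g)
        expand = solve-∀
        collect : ∀ xn b a w g → b * (xn * w) - a * xn * (b * g) ≡ (w - a * g) * (xn * b)
        collect = solve-∀

    witness : Σ ℕ λ m → Σ ℕ λ n → Σ (x n ≢ 0ℤ) λ x[n]≢0 → PAdicSmall p e (quot x m n x[n]≢0 ℚ.- q)
    witness =
      let d′ , B*Gn≡p^h*d′ , p∤d′ = exactPrimePower-stable p-prime h D B*Gn≡p^hD p∤D
      in  m , n , x[n]≢0 ,
          PAdicSmall-intro p-prime {h = h} e (quot-q≐ d′ B*Gn≡p^h*d′) p∤d′ p^[h+e]∣W-A*Gn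

  quotientSet-dense : QuotientSetDenseInQp p x
  quotientSet-dense q e =
    let h , D , Bγ≡p^hD , p∤D = primePowerSplit p-prime (↧ₙ q ℕ.* γ) {{ℕₚ.m*n≢0 (↧ₙ q) γ}}
        ρ′ , a^ρ≡1            = ∃-order p-prime {a} p∤a (suc (h ℕ.+ e))
    in  Witness.witness q e h D Bγ≡p^hD p∤D ρ′ a^ρ≡1

theorem1p3 : (k : ℕ) → k ≥ 2 → (b : ℕ → ℤ) → b k ≢ 0ℤ → (x : ℕ → ℤ)
    → Recurrence k b x → InitialValues k x
    → (p : ℕ) → Prime p → (a : ℤ) → charPoly k b ≡ (X- a) ^ₚ k → ¬ (+ p ∣ a)
    → QuotientSetDenseInQp p x
theorem1p3 (suc zero) (s≤s ())
theorem1p3 (suc (suc j)) _ b _ x rec-x initial p p-prime a charPoly≡ p∤a =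
  quotientSet-dense p-prime p∤a x j (+ (suc j !) * a) {{c≢0}}
    (λ N → rising (1ℤ + + N) j) (λ N → rising-nonZero N j) (j !) {{j !≢0}} (rising[1+N]≡j!-mod j)
    (Recurrence-scaledClosedForm j b x a rec-x initial charPoly≡)
  where
  open ℕₚ using (_!≢0)
  a≢0 : a ≢ 0ℤ
  a≢0 refl = p∤a (ℕ∣._∣0 p)
  c≢0 : ℤ.NonZero (+ (suc j !) * a)
  c≢0 = ℤₚ.i*j≢0 (+ (suc j !)) a {{suc j !≢0}} {{ℤ.≢-nonZero a≢0}}
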